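{- For every $N\ge 3$, $\mathcal G_1(N)\cap\mathcal G_2(N)=\emptyset$, where $\mathcal G_1(N)$ is the set of graphs $G$ with $c(G)>N-1$ for which some noncapture state $s$ has $c(G|s)\in\{2,\dots,N-1\}$, and $\mathcal G_2(N)$ is the set of graphs $G$ with $c(G)>N-1$ such that $c(G|s)=\infty$ for every noncapture state $s$ in which the robber moves next.
   Context: Graphs are finite, undirected, connected and simple; $c(G)$ is the classical cop number. There are $N$ tokens on $G$: cops $C_1,\dots,C_{N-1}$ (tokens $1,\dots,N-1$) and a robber $R$ (token $N$). A state is $s=(x^1,\dots,x^N,n)$, $x^i\in V$ the location of token $i$, $n$ the token moving next. $s$ is a capture state if $x^i=x^N$ for some $i\le N-1$, otherwise a noncapture state. In each turn only the token to move moves, to a vertex of its closed neighbourhood (it may stay put), and the turn passes cyclically $C_1,\dots,C_{N-1},R,C_1,\dots$; play stops at capture. State cop number: for a noncapture state $s$, $c(G|s)$ is the least $k\in\{1,\dots,N-1\}$ such that some $k$ of the cops have strategies which, starting from $s$, lead to capture (by any cop) against all strategies of the remaining $N-k$ tokens (including $R$); $c(G|s)=\infty$ if no such $k$ exists. -}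

module Defs where

open import Data.Nat using (ℕ; zero; suc; _≤_; _<_; _∸_; NonZero)
open import Data.Nat.Properties using (_<?_)
open import Data.Fin using (Fin; toℕ; fromℕ<; _≟_)
open import Data.Fin.Subset using (Subset; _∈_; ∣_∣)
open import Data.Vec using (Vec; lookup; _[_]≔_)
open import Data.Bool using (Bool; true; false)
open import Data.Product using (Σ; ∃; ∃-syntax; _×_; _,_)
open import Data.Sum using (_⊎_)
open import Relation.Nullary using (¬_; yes; no)
open import Relation.Binary.PropositionalEquality using (_≡_; _≢_)

data Walk {n : ℕ} (adj : Fin n → Fin n → Bool) : Fin n → Fin n → Set where
  here : ∀ {u} → Walk adj u u
  step : ∀ {u w v} → adj u w ≡ true → Walk adj w v → Walk adj u v

record Graph : Set where
  field
    n         : ℕ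
    {{nonempty}} : NonZero n
    adj       : Fin n → Fin n → Bool
    irrefl    : ∀ u → adj u u ≡ false
    sym       : ∀ u v → adj u v ≡ adj v u
    connected : ∀ u v → Walk adj u v

open Graph public

V : Graph → Set
V G = Fin (n G)

InClosedNbhd : (G : Graph) → V G → V G → Set
InClosedNbhd G u v = (u ≡ v) ⊎ (adj G u v ≡ true)

-- Game with k cops: cops choose initial positions, then the robber,
-- then rounds: all cops move simultaneously (each to its closed
-- neighbourhood), then the robber moves.

CCaptured : (G : Graph) {k : ℕ} → Vec (V G) k → V G → Set
CCaptured G cs r = ∃[ i ] lookup cs i ≡ r

data CWin (G : Graph) {k : ℕ} : Vec (V G) k → V G → Bool → Set where
  cap     : ∀ {cs r b} → CCaptured G cs r → CWin G cs r b
  copMove : ∀ {cs r} (cs' : Vec (V G) k) →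
            (∀ i → InClosedNbhd G (lookup cs i) (lookup cs' i)) →
            CWin G cs' r false → CWin G cs r true
  robMove : ∀ {cs r} →
            (∀ r' → InClosedNbhd G r r' → CWin G cs r' true) →
            CWin G cs r false

CopsWin : Graph → ℕ → Set
CopsWin G k = ∃[ cs ] ∀ (r : V G) → CWin G {k} cs r true

CopNumber> : Graph → ℕ → Set
CopNumber> G m = ∀ k → k ≤ m → ¬ CopsWin G k

IsCop : {N : ℕ} → Fin N → Set
IsCop {N} i = suc (toℕ i) < N

IsRobber : {N : ℕ} → Fin N → Set
IsRobber {N} i = suc (toℕ i) ≡ N

nextTok : {N : ℕ} → Fin N → Fin N
nextTok {suc k} i with suc (toℕ i) <? suc k
... | yes p = fromℕ< p
... | no _  = Fin.zero

record State (G : Graph) (N : ℕ) : Set where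
  constructor ⟨_,_⟩
  field
    pos  : Vec (V G) N
    turn : Fin N

open State public

IsCapture : {G : Graph} {N : ℕ} → State G N → Set
IsCapture s = ∃[ i ] ∃[ j ] IsCop i × IsRobber j × lookup (pos s) i ≡ lookup (pos s) j

NonCapture : {G : Graph} {N : ℕ} → State G N → Set
NonCapture s = ¬ IsCapture s

data Win (G : Graph) {N : ℕ} (S : Subset N) : State G N → Set where
  captured : ∀ {s} → IsCapture s → Win G S s
  ownMove  : ∀ {x t} → t ∈ S → (v : V G) → InClosedNbhd G (lookup x t) v →
             Win G S ⟨ x [ t ]≔ v , nextTok t ⟩ → Win G S ⟨ x , t ⟩
  othMove  : ∀ {x t} → ¬ (t ∈ S) →
             (∀ v → InClosedNbhd G (lookup x t) v →
                    Win G S ⟨ x [ t ]≔ v , nextTok t ⟩) →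
             Win G S ⟨ x , t ⟩

SomeCopsWin : (G : Graph) {N : ℕ} → State G N → ℕ → Set
SomeCopsWin G {N} s k =
  ∃[ S ] (∀ i → i ∈ S → IsCop i) × ∣ S ∣ ≡ k × Win G S s

StateCopNumber≡ : (G : Graph) {N : ℕ} → State G N → ℕ → Set
StateCopNumber≡ G {N} s k =
  1 ≤ k × k ≤ N ∸ 1 × SomeCopsWin G s k ×
  (∀ j → 1 ≤ j → j < k → ¬ SomeCopsWin G s j)

StateCopNumber∞ : (G : Graph) {N : ℕ} → State G N → Set
StateCopNumber∞ G {N} s = ∀ k → 1 ≤ k → k ≤ N ∸ 1 → ¬ SomeCopsWin G s k

𝒢₁ : ℕ → Graph → Set
𝒢₁ N G = CopNumber> G (N ∸ 1) ×
  ∃[ s ] NonCapture {G} {N} s × ∃[ k ] 2 ≤ k × k ≤ N ∸ 1 × StateCopNumber≡ G s k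

𝒢₂ : ℕ → Graph → Set
𝒢₂ N G = CopNumber> G (N ∸ 1) ×
  (∀ (s : State G N) → NonCapture s → IsRobber (turn s) → StateCopNumber∞ G s)

module Submission where

-- Suppose G lies in both classes.  From 𝒢₁ we get a noncapture state
-- s = ⟨ x , u ⟩ and a coalition S of k ≥ 2 cops winning from s, while no
-- single cop wins from s.  If the robber is to move in s, 𝒢₂ is violated
-- at once.  Otherwise let S play its strategy while all cops outside S stay
-- put, through the cop turns u, u+1, … up to the robber's turn.  Either no
-- cop ever steps onto the robber, and we reach a noncapture state with the
-- robber to move that S still wins, again contradicting 𝒢₂; or some cop t
-- (at or after u) steps onto the robber.  Since neither t nor the robber
-- moves before t's turn, t was already within one step of the robber in s,
-- so the coalition {t} alone wins from s, contradicting c(G|s) = k ≥ 2.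

open import Defs hiding (sym)
open import Data.Nat using (ℕ; zero; suc; _+_; _∸_; _≤_; _<_; s≤s)
open import Data.Nat.Properties
  using (_<?_; m≤n⇒m<n∨m≡n; <-irrefl; <⇒≱; suc-injective; +-suc; m≤m+n; m≤n+m; m∸n+n≡m; ≤-refl; <-trans; <⇒≤)
open import Data.Fin using (Fin; toℕ; fromℕ; _≟_)
open import Data.Fin.Properties using (toℕ<n; toℕ-fromℕ; toℕ-fromℕ<; toℕ-injective)
open import Data.Fin.Subset using (Subset; _∈_; ⁅_⁆)
open import Data.Fin.Subset.Properties using (_∈?_; x∈⁅x⁆; x∈⁅y⁆⇒x≡y; ∣⁅x⁆∣≡1)
open import Data.Vec using (Vec; lookup; _[_]≔_)
open import Data.Vec.Properties using (lookup∘update; lookup∘update′)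
open import Data.Product using (_×_; _,_; ∃-syntax)
open import Data.Sum using (_⊎_; inj₁; inj₂)
open import Data.Empty using (⊥-elim)
open import Relation.Nullary using (¬_; yes; no)
open import Relation.Binary.PropositionalEquality
  using (_≡_; _≢_; refl; sym; trans; cong; subst; subst₂; module ≡-Reasoning)

cop-or-robber : {N : ℕ} (i : Fin N) → IsCop i ⊎ IsRobber i
cop-or-robber i = m≤n⇒m<n∨m≡n (toℕ<n i)

cop≢robber : {N : ℕ} {i j : Fin N} → IsCop i → IsRobber j → i ≢ j
cop≢robber ci rj refl = <-irrefl rj ci

robber-unique : {N : ℕ} {i j : Fin N} → IsRobber i → IsRobber j → i ≡ j
robber-unique ri rj = toℕ-injective (suc-injective (trans ri (sym rj)))

nextTok-cop : {N : ℕ} (u : Fin N) → IsCop u → toℕ (nextTok u) ≡ suc (toℕ u)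
nextTok-cop {suc k} u cu with suc (toℕ u) <? suc k
... | yes p = toℕ-fromℕ< p
... | no ¬p = ⊥-elim (¬p cu)

lastIsRobber : (M : ℕ) → IsRobber (fromℕ M)
lastIsRobber M = cong suc (toℕ-fromℕ M)

unmoved : {A : Set} {N : ℕ} {u i : Fin N} → u ≢ i → (x : Vec A N) (v : A) →
          lookup (x [ u ]≔ v) i ≡ lookup x i
unmoved u≢i x v = lookup∘update′ (λ i≡u → u≢i (sym i≡u)) x v

RobberTurnWin : (G : Graph) {N : ℕ} → Subset N → Set
RobberTurnWin G {N} S = ∃[ s ] NonCapture {G} {N} s × IsRobber (turn s) × Win G S s

singleCopWins : (G : Graph) {N : ℕ} {s : State G N} (t : Fin N) → IsCop t →
                Win G ⁅ t ⁆ s → SomeCopsWin G s 1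
singleCopWins G t ct w =
  ⁅ t ⁆ , (λ i i∈t → subst IsCop (sym (x∈⁅y⁆⇒x≡y t i∈t)) ct) , ∣⁅x⁆∣≡1 t , w

module Play (G : Graph) {N : ℕ} (r : Fin N) (rr : IsRobber r) where

  open ≡-Reasoning

  Threatens : Vec (V G) N → Fin N → Set
  Threatens x t = InClosedNbhd G (lookup x t) (lookup x r)

  threat-kept : (x : Vec (V G) N) {u t : Fin N} (v : V G) → IsCop u → u ≢ t →
                Threatens x t → Threatens (x [ u ]≔ v) t
  threat-kept x v cu u≢t =
    subst₂ (InClosedNbhd G) (sym (unmoved u≢t x v)) (sym (unmoved (cop≢robber cu rr) x v))

  threat-restored : (x : Vec (V G) N) {u t : Fin N} (v : V G) → IsCop u → u ≢ t →
                    Threatens (x [ u ]≔ v) t → Threatens x t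
  threat-restored x v cu u≢t =
    subst₂ (InClosedNbhd G) (unmoved u≢t x v) (unmoved (cop≢robber cu rr) x v)

  noncapture-kept : (x : Vec (V G) N) (u : Fin N) (v : V G) → IsCop u →
                    NonCapture {G} ⟨ x , u ⟩ → v ≢ lookup x r →
                    NonCapture {G} ⟨ x [ u ]≔ v , nextTok u ⟩
  noncapture-kept x u v cu nc v≢r (i , j , ci , rj , xi≡xj)
    with robber-unique rj rr | i ≟ u
  ... | refl | yes refl = v≢r (trans (sym (lookup∘update u x v))
                                     (trans xi≡xj (unmoved (cop≢robber cu rr) x v)))
  ... | refl | no i≢u = nc (i , r , ci , rr ,
                           trans (sym (unmoved (λ u≡i → i≢u (sym u≡i)) x v))
                                 (trans xi≡xj (unmoved (cop≢robber cu rr) x v)))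

  -- A coalition may always let the token to move pass: if it wins after
  -- every move of u, it wins at u's turn (a member of S simply stays put).
  winsIfAllMovesWin : (S : Subset N) (x : Vec (V G) N) (u : Fin N) →
    (∀ v → InClosedNbhd G (lookup x u) v → Win G S ⟨ x [ u ]≔ v , nextTok u ⟩) →
    Win G S ⟨ x , u ⟩
  winsIfAllMovesWin S x u h with u ∈? S
  ... | yes u∈S = ownMove u∈S (lookup x u) (inj₁ refl) (h (lookup x u) (inj₁ refl))
  ... | no u∉S  = othMove u∉S h

  -- A cop t ∈ S that threatens the robber before the robber's next turn
  -- wins for S: the cops moving before t cannot displace t or the robber,
  -- and t then steps onto the robber.  Here k counts the turns before t's.
  threatWins : (S : Subset N) (t : Fin N) → t ∈ S → IsCop t →
               ∀ k (x : Vec (V G) N) (u : Fin N) → toℕ t ≡ k + toℕ u →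
               Threatens x t → Win G S ⟨ x , u ⟩
  threatWins S t t∈S ct zero x u t≡u th with toℕ-injective {i = t} {j = u} t≡u
  ... | refl = ownMove t∈S (lookup x r) th (captured (t , r , ct , rr , captureSquare))
    where
    captureSquare : lookup (x [ t ]≔ lookup x r) t ≡ lookup (x [ t ]≔ lookup x r) r
    captureSquare = trans (lookup∘update t x (lookup x r))
                          (sym (unmoved (cop≢robber ct rr) x (lookup x r)))
  threatWins S t t∈S ct (suc k) x u t≡k+1+u th =
    winsIfAllMovesWin S x u λ v _ →
      threatWins S t t∈S ct k (x [ u ]≔ v) (nextTok u) t≡k+u' (threat-kept x v cu u≢t th)
    where
    u<t : toℕ u < toℕ t
    u<t = subst (toℕ u <_) (sym t≡k+1+u) (s≤s (m≤n+m (toℕ u) k))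
    u≢t : u ≢ t
    u≢t u≡t = <-irrefl (cong toℕ u≡t) u<t
    cu : IsCop u
    cu = <-trans (s≤s u<t) ct
    t≡k+u' : toℕ t ≡ k + toℕ (nextTok u)
    t≡k+u' = begin
      toℕ t                   ≡⟨ t≡k+1+u ⟩
      suc (k + toℕ u)         ≡⟨ sym (+-suc k (toℕ u)) ⟩
      k + suc (toℕ u)         ≡⟨ cong (k +_) (sym (nextTok-cop u cu)) ⟩
      k + toℕ (nextTok u)     ∎

  copTurn : {S : Subset N} {x : Vec (V G) N} {u : Fin N} → IsCop u →
            NonCapture {G} ⟨ x , u ⟩ → Win G S ⟨ x , u ⟩ →
            Threatens x u ⊎
            ∃[ v ] NonCapture {G} ⟨ x [ u ]≔ v , nextTok u ⟩ × Win G S ⟨ x [ u ]≔ v , nextTok u ⟩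
  copTurn cu nc (captured capture) = ⊥-elim (nc capture)
  copTurn {x = x} {u} cu nc (ownMove _ v nb w) with v ≟ lookup x r
  ... | yes refl = inj₁ nb
  ... | no v≢r   = inj₂ (v , noncapture-kept x u v cu nc v≢r , w)
  copTurn {x = x} {u} cu nc (othMove _ allMovesWin) =
    inj₂ (lookup x u , noncapture-kept x u (lookup x u) cu nc copNotOnRobber ,
          allMovesWin (lookup x u) (inj₁ refl))
    where
    copNotOnRobber : lookup x u ≢ lookup x r
    copNotOnRobber xu≡xr = nc (u , r , cu , rr , xu≡xr)

  -- The fuel d bounds the number of remaining cop turns.
  followToRobber : (S : Subset N) → ∀ d (x : Vec (V G) N) (u : Fin N) →
    N ≤ d + toℕ u → IsCop u → NonCapture {G} ⟨ x , u ⟩ → Win G S ⟨ x , u ⟩ →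
    RobberTurnWin G S ⊎ ∃[ t ] IsCop t × toℕ u ≤ toℕ t × Threatens x t
  followToRobber S zero x u N≤u cu nc w = ⊥-elim (<⇒≱ (toℕ<n u) N≤u)
  followToRobber S (suc d) x u N≤d+1+u cu nc w with copTurn cu nc w
  ... | inj₁ th = inj₂ (u , cu , ≤-refl , th)
  ... | inj₂ (v , nc′ , w′) with cop-or-robber (nextTok u)
  ...   | inj₂ robberNext = inj₁ (_ , nc′ , robberNext , w′)
  ...   | inj₁ copNext with followToRobber S d (x [ u ]≔ v) (nextTok u) fuel copNext nc′ w′
    where
    fuel : N ≤ d + toℕ (nextTok u)
    fuel = subst (N ≤_) (trans (sym (+-suc d (toℕ u))) (cong (d +_) (sym (nextTok-cop u cu))))
                 N≤d+1+u
  ...     | inj₁ found = inj₁ found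
  ...     | inj₂ (t , ct , u′≤t , th) = inj₂ (t , ct , <⇒≤ u<t , threat-restored x v cu u≢t th)
    where
    u<t : toℕ u < toℕ t
    u<t = subst (_≤ toℕ t) (nextTok-cop u cu) u′≤t
    u≢t : u ≢ t
    u≢t u≡t = <-irrefl (cong toℕ u≡t) u<t

open Play using (threatWins; followToRobber)

-- The robber is the last token fromℕ M; the hypothesis N ≥ 3 is only
-- needed to make 𝒢₁ satisfiable (2 ≤ k ≤ N - 1) and is otherwise unused.
lemma12 : ∀ (N : ℕ) → 3 ≤ N → ∀ (G : Graph) → ¬ (𝒢₁ N G × 𝒢₂ N G)
lemma12 (suc M) _ G
  ( (_ , ⟨ x , u ⟩ , nc , k , 2≤k , k≤M , (1≤k , _ , (S , S-cops , ∣S∣≡k , w) , minimal))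
  , (_ , robberTurnLost) )
  with cop-or-robber u
... | inj₂ ru = robberTurnLost ⟨ x , u ⟩ nc ru k 1≤k k≤M (S , S-cops , ∣S∣≡k , w)
... | inj₁ cu
  with followToRobber G (fromℕ M) (lastIsRobber M) S (suc M) x u (m≤m+n (suc M) (toℕ u)) cu nc w
...   | inj₁ (s′ , nc′ , rs′ , w′) =
  robberTurnLost s′ nc′ rs′ k 1≤k k≤M (S , S-cops , ∣S∣≡k , w′)
...   | inj₂ (t , ct , u≤t , th) =
  minimal 1 ≤-refl 2≤k (singleCopWins G t ct
    (threatWins G (fromℕ M) (lastIsRobber M) ⁅ t ⁆ t (x∈⁅x⁆ t) ct
                (toℕ t ∸ toℕ u) x u (sym (m∸n+n≡m u≤t)) th))
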